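{- Let $T$ be the $n$-vertex spider, i.e. the tree with vertices $u$, $v_1,\dots,v_{\lfloor n/2\rfloor}$ and $w_1,\dots,w_{n-\lfloor n/2\rfloor-1}$, where $u$ is adjacent to every $v_i$ and $v_i$ is adjacent to $w_i$ for each $1\le i\le n-\lfloor n/2\rfloor-1$. Suppose the hidden tree on the known $n$-element vertex set $V$ is known to be isomorphic to $T$ (but the identification of vertices is unknown). Then the smallest number of distance queries in an adaptive algorithm that determines the hidden copy of $T$ (i.e. guarantees that exactly one tree on $V$ isomorphic to $T$ is consistent with the answers) is $\frac{n^2}{8}+O(n)$.
   Context: A distance query is an unordered pair $\{x,y\}$ of distinct vertices of $V$, answered by the distance of $x$ and $y$ in the hidden tree. In an adaptive algorithm each query may depend on previous answers. A tree is consistent with the answers if its distances agree with all answers received. -}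

module Defs where

open import Data.Nat using (ℕ; zero; suc; _+_; _≤_; _≡ᵇ_; _≤ᵇ_; ⌊_/2⌋)
open import Data.Bool using (Bool; T; _∧_; _∨_)
open import Data.Fin using (Fin; toℕ)
open import Data.Fin.Permutation using (Permutation′; _⟨$⟩ˡ_)
open import Data.List using (List; []; _∷_)
open import Data.List.Relation.Unary.All using (All)
open import Data.Product using (_×_)
open import Relation.Binary.PropositionalEquality using (_≡_; _≢_)

Graph : ℕ → Set
Graph n = Fin n → Fin n → Bool

data Walk {n : ℕ} (G : Graph n) : Fin n → Fin n → ℕ → Set where
  here : ∀ {x} → Walk G x x 0
  step : ∀ {x y z k} → T (G x y) → Walk G y z k → Walk G x z (suc k)

Dist : {n : ℕ} → Graph n → Fin n → Fin n → ℕ → Set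
Dist G x y d = Walk G x y d × (∀ k → Walk G x y k → d ≤ k)

-- Edges of the spider with k = ⌊n/2⌋ legs-of-type-v, on labels 0..n-1:
-- 0 = u, 1..k = v_1..v_k, k+j = w_j  (1 ≤ j ≤ n - k - 1).
-- u ~ v_i for all i, and v_i ~ w_i.
spiderEdgeℕ : ℕ → ℕ → ℕ → Bool
spiderEdgeℕ k a b =
  ((a ≡ᵇ 0) ∧ ((1 ≤ᵇ b) ∧ (b ≤ᵇ k))) ∨ (((1 ≤ᵇ a) ∧ (a ≤ᵇ k)) ∧ (b ≡ᵇ (a + k)))

spider : (n : ℕ) → Graph n
spider n a b = spiderEdgeℕ ⌊ n /2⌋ (toℕ a) (toℕ b) ∨ spiderEdgeℕ ⌊ n /2⌋ (toℕ b) (toℕ a)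

-- The copy of T on V = Fin n obtained by identifying T-vertex t with V-vertex π t.
copy : {n : ℕ} → Permutation′ n → Graph n
copy {n} π a b = spider n (π ⟨$⟩ˡ a) (π ⟨$⟩ˡ b)

record Answer (n : ℕ) : Set where
  constructor ⟨_,_↦_⟩
  field
    qx qy : Fin n
    dist : ℕ

Consistent : {n : ℕ} → Permutation′ n → List (Answer n) → Set
Consistent π as = All (λ a → Dist (copy π) (Answer.qx a) (Answer.qy a) (Answer.dist a)) as

-- Exactly one tree on V isomorphic to T is consistent: any two consistent
-- copies are the same labelled tree (existence holds since the hidden tree is consistent).
Determined : {n : ℕ} → List (Answer n) → Set
Determined {n} as = ∀ (π ρ : Permutation′ n) → Consistent π as → Consistent ρ as →
                    ∀ a b → copy π a b ≡ copy ρ a b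

-- Solves q as : starting from the answers `as`, an adaptive algorithm can, using at
-- most q further distance queries (each on two distinct vertices, the next query
-- depending on all previous answers), reach a state where the hidden copy is determined,
-- whatever the answers are.
data Solves {n : ℕ} : ℕ → List (Answer n) → Set where
  stop  : ∀ {q as} → Determined as → Solves q as
  query : ∀ {q as} (x y : Fin n) → x ≢ y →
          (∀ d → Solves q (⟨ x , y ↦ d ⟩ ∷ as)) → Solves (suc q) as

-- Write k = ⌊n/2⌋ for the number of v's and K = n − k − 1 ≤ k for the number of w's.
--
-- The adversary only considers copies that put u and v_1 … v_k on
-- fixed vertices, so that just the w's are unknown, and it answers 1 only when
-- every such copy consistent so far forces it.  Once the copy is determined,
-- exchanging two w-vertices x₁, x₂ yields another such copy, so some unforced
-- answer tells the two apart; that query must join one of x₁, x₂ to the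
-- v-neighbour of the other.  A query can do this for at most one pair, hence at
-- least K(K−1)/2 ≈ n²/8 queries are needed.
--
-- Querying a vertex a against all others shows whether a is u (no
-- distance exceeds 2); otherwise a vertex at distance 2 (if some distance is 4,
-- so that a is a w) or at distance 1 (a is a v) is closer to u, and three such
-- rounds of n queries locate u.  The distances from u separate the v's from the
-- w's, and each w is matched with its v by querying the unmatched v's in turn:
-- at most k + (k − 1) + … ≤ k(k+1)/2 ≈ n²/8 further queries.

{-# OPTIONS --safe #-}
module Submission where

open import Data.Bool using (true; false; T; _∧_; _∨_; if_then_else_)
open import Data.Bool.Properties using (T-∧; T-∨; T-≡; ¬-not)
open import Data.Empty using (⊥-elim)
open import Data.Fin using (Fin; zero; suc; toℕ; fromℕ<; splitAt; join)
open import Data.Fin.Permutation using (Permutation′; _⟨$⟩ˡ_; _⟨$⟩ʳ_; inverseˡ; inverseʳ; _∘ₚ_; transpose; id)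
import Data.Fin.Permutation.Components as PC
open import Data.Fin.Properties using (toℕ-injective; toℕ-fromℕ<; toℕ<n; join-splitAt; injective⇒≤; all?; any?) renaming (_≟_ to _≟ᶠ_)
open import Data.List using (List; []; _∷_; length; lookup; allFin; map; filter; _++_)
open import Data.List.Membership.Propositional using (_∈_; _∉_)
open import Data.List.Membership.Propositional.Properties using (∈-lookup; ∈-allFin; ∈-map⁺; ∈-map⁻; ∈-filter⁺; ∈-filter⁻; ∈-++⁻)
open import Data.List.Properties using (length-tabulate; length-map; length-++)
open import Data.List.Relation.Binary.Subset.Propositional using (_⊆_)
open import Data.List.Relation.Unary.All as All using (All; []; _∷_)
open import Data.List.Relation.Unary.All.Properties using (anti-mono; all-filter; ¬Any⇒All¬; All¬⇒¬Any)
open import Data.List.Relation.Unary.AllPairs using ([]; _∷_)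
open import Data.List.Relation.Unary.Any as Any using (Any; here; there)
open import Data.List.Relation.Unary.Any.Properties using (lookup-index)
open import Data.List.Relation.Unary.Unique.Propositional using (Unique)
import Data.List.Relation.Unary.Unique.Propositional.Properties as Unique
open import Data.Nat using (ℕ; zero; suc; _+_; _*_; _∸_; _≤_; _<_; _≡ᵇ_; _≤ᵇ_; ⌊_/2⌋; ⌈_/2⌉; z≤n; s≤s)
open import Data.Nat.Properties
open import Data.Nat.Tactic.RingSolver using (solve-∀)
open import Data.Product using (_×_; _,_; proj₁; proj₂; ∃; ∃₂)
import Data.Product as Product
open import Data.Sum using (_⊎_; inj₁; inj₂; [_,_])
import Data.Sum as Sum
open import Data.Unit using (⊤; tt)
open import Data.Vec.Functional using (updateAt)
open import Data.Vec.Functional.Properties using (updateAt-updates; updateAt-minimal)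
open import Effect.Monad using (RawMonad)
open import Function using (flip)
open import Function.Bundles using (Equivalence)
open import Level using (0ℓ)
open import Relation.Binary.PropositionalEquality hiding ([_])
open import Relation.Nullary using (¬_; Dec; yes; no; contradiction)
open import Relation.Nullary.Decidable using (toSum; decidable-stable; ¬¬-excluded-middle; ¬?; _×-dec_; _⊎-dec_)
open import Relation.Nullary.Negation using (¬¬-Monad)

open import Defs

open Equivalence using (to; from)
open RawMonad (¬¬-Monad {a = 0ℓ}) using (pure; _>>=_; _<$>_)

T-injective : ∀ {x y} → (T x → T y) → (T y → T x) → x ≡ y
T-injective {false} {false} _ _ = refl
T-injective {false} {true}  _ g = ⊥-elim (g tt)
T-injective {true}  {false} f _ = ⊥-elim (f tt)
T-injective {true}  {true}  _ _ = refl

≡ᵇ-refl : ∀ i → (i ≡ᵇ i) ≡ true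
≡ᵇ-refl i = to T-≡ (≡⇒≡ᵇ i i refl)

≡ᵇ-sym : ∀ i j → (i ≡ᵇ j) ≡ (j ≡ᵇ i)
≡ᵇ-sym i j = T-injective (λ t → ≡⇒≡ᵇ j i (sym (≡ᵇ⇒≡ i j t)))
                         (λ t → ≡⇒≡ᵇ i j (sym (≡ᵇ⇒≡ j i t)))

≢⇒≡ᵇ-false : ∀ {i j} → i ≢ j → (i ≡ᵇ j) ≡ false
≢⇒≡ᵇ-false {i} {j} i≢j = ¬-not λ eq → i≢j (≡ᵇ⇒≡ i j (from T-≡ eq))

half-lower : ∀ n → ⌊ n /2⌋ + ⌊ n /2⌋ ≤ n
half-lower zero = z≤n
half-lower (suc zero) = z≤n
half-lower (suc (suc n)) rewrite +-suc ⌊ n /2⌋ ⌊ n /2⌋ = s≤s (s≤s (half-lower n))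

half-upper : ∀ n → n ≤ suc (⌊ n /2⌋ + ⌊ n /2⌋)
half-upper zero = z≤n
half-upper (suc zero) = s≤s z≤n
half-upper (suc (suc n)) rewrite +-suc ⌊ n /2⌋ ⌊ n /2⌋ = s≤s (s≤s (half-upper n))

transpose-ˡ : ∀ {n} (i j : Fin n) → PC.transpose i j i ≡ j
transpose-ˡ i j with i ≟ᶠ i
... | yes _ = refl
... | no i≢i = contradiction refl i≢i

transpose-ʳ : ∀ {n} (i j : Fin n) → PC.transpose i j j ≡ i
transpose-ʳ i j with j ≟ᶠ i
... | yes j≡i = j≡i
... | no _ with j ≟ᶠ j
...   | yes _ = refl
...   | no j≢j = contradiction refl j≢j

transpose-other : ∀ {n} {i j l : Fin n} → l ≢ i → l ≢ j → PC.transpose i j l ≡ l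
transpose-other {i = i} {j} {l} l≢i l≢j with l ≟ᶠ i
... | yes l≡i = contradiction l≡i l≢i
... | no _ with l ≟ᶠ j
...   | yes l≡j = contradiction l≡j l≢j
...   | no _ = refl

Unique-lookup-injective : ∀ {A : Set} {xs : List A} → Unique xs → ∀ {i j} → lookup xs i ≡ lookup xs j → i ≡ j
Unique-lookup-injective (_ ∷ _) {zero} {zero} _ = refl
Unique-lookup-injective (x∉ ∷ _) {zero} {suc j} eq = contradiction eq (All.lookup x∉ (∈-lookup j))
Unique-lookup-injective (x∉ ∷ _) {suc i} {zero} eq = contradiction (sym eq) (All.lookup x∉ (∈-lookup i))
Unique-lookup-injective (_ ∷ u) {suc i} {suc j} eq = cong suc (Unique-lookup-injective u eq)

Unique-⊆-length : ∀ {A : Set} {xs ys : List A} → Unique xs → xs ⊆ ys → length xs ≤ length ys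
Unique-⊆-length {xs = xs} {ys} u xs⊆ys = injective⇒≤ position-injective
  where
  position : Fin (length xs) → Fin (length ys)
  position i = Any.index (xs⊆ys (∈-lookup i))
  position-injective : ∀ {i j} → position i ≡ position j → i ≡ j
  position-injective {i} {j} eq = Unique-lookup-injective u
    (trans (lookup-index (xs⊆ys (∈-lookup i))) (trans (cong (lookup ys) eq) (sym (lookup-index (xs⊆ys (∈-lookup j))))))

choose2 : ℕ → ℕ
choose2 zero = 0
choose2 (suc K) = choose2 K + K

pairAt : ∀ K → Fin (choose2 K) → ℕ × ℕ
pairAt (suc K) e = [ pairAt K , (λ i → toℕ i , K) ] (splitAt (choose2 K) e)

pairAt-< : ∀ K e → proj₁ (pairAt K e) < proj₂ (pairAt K e) × proj₂ (pairAt K e) < K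
pairAt-< (suc K) e with splitAt (choose2 K) e
... | inj₁ e′ = Product.map₂ m<n⇒m<1+n (pairAt-< K e′)
... | inj₂ i = toℕ<n i , ≤-refl

pairAt-injective : ∀ K {e e′} → pairAt K e ≡ pairAt K e′ → e ≡ e′
pairAt-injective (suc K) {e} {e′} eq =
  trans (sym (join-splitAt (choose2 K) K e))
        (trans (cong (join (choose2 K) K) (split-injective (splitAt _ e) (splitAt _ e′) eq))
               (join-splitAt (choose2 K) K e′))
  where
  split-injective : ∀ s s′ → [ pairAt K , (λ i → toℕ i , K) ] s ≡ [ pairAt K , (λ i → toℕ i , K) ] s′ →
                    s ≡ s′
  split-injective (inj₁ e₁) (inj₁ e₂) eq = cong inj₁ (pairAt-injective K eq)
  split-injective (inj₁ e₁) (inj₂ _) eq = contradiction (cong proj₂ eq) (<⇒≢ (proj₂ (pairAt-< K e₁)))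
  split-injective (inj₂ _) (inj₁ e₂) eq = contradiction (sym (cong proj₂ eq)) (<⇒≢ (proj₂ (pairAt-< K e₂)))
  split-injective (inj₂ i) (inj₂ j) eq = cong inj₂ (toℕ-injective (cong proj₁ eq))

choose2-shrink : ∀ a t → choose2 (suc (a ∸ suc t)) ≤ choose2 (a ∸ t)
choose2-shrink zero t = z≤n
choose2-shrink (suc a) zero = ≤-refl
choose2-shrink (suc a) (suc t) = choose2-shrink a t

2*choose2 : ∀ K → 2 * choose2 (suc K) ≡ suc K * K
2*choose2 zero = refl
2*choose2 (suc K) = begin
  2 * (choose2 (suc K) + suc K)     ≡⟨ *-distribˡ-+ 2 (choose2 (suc K)) (suc K) ⟩
  2 * choose2 (suc K) + 2 * suc K   ≡⟨ cong (_+ 2 * suc K) (2*choose2 K) ⟩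
  suc K * K + 2 * suc K             ≡⟨ expand K ⟩
  suc (suc K) * suc K               ∎
  where
  open ≡-Reasoning
  expand : ∀ K → suc K * K + 2 * suc K ≡ suc (suc K) * suc K
  expand = solve-∀

Solves-mono : ∀ {n q q′} {as : List (Answer n)} → q ≤ q′ → Solves q as → Solves q′ as
Solves-mono _ (stop det) = stop det
Solves-mono (s≤s q≤q′) (query x y x≢y next) = query x y x≢y λ d → Solves-mono q≤q′ (next d)

module _ {n : ℕ} {G : Graph n} where

  _++ʷ_ : ∀ {x y z a b} → Walk G x y a → Walk G y z b → Walk G x z (a + b)
  here ++ʷ w = w
  step e w ++ʷ w′ = step e (w ++ʷ w′)

  reverseʷ : (∀ {x y} → T (G x y) → T (G y x)) → ∀ {x y L} → Walk G x y L → Walk G y x L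
  reverseʷ G-sym here = here
  reverseʷ G-sym (step {k = L} e w) = subst (Walk G _ _) (+-comm L 1) (reverseʷ G-sym w ++ʷ step (G-sym e) here)

  mapʷ : ∀ {H : Graph n} (f : Fin n → Fin n) → (∀ {x y} → T (G x y) → T (H (f x) (f y))) →
         ∀ {x y L} → Walk G x y L → Walk H (f x) (f y) L
  mapʷ f hom here = here
  mapʷ f hom (step e w) = step (hom e) (mapʷ f hom w)

  Dist-unique : ∀ {x y d d′} → Dist G x y d → Dist G x y d′ → d ≡ d′
  Dist-unique {d = d} {d′} (w , min) (w′ , min′) = ≤-antisym (min d′ w′) (min′ d w)

data Role : Set where
  U : Role
  V W : ℕ → Role

role : ℕ → ℕ → Role
role k zero = U
role k (suc a) with suc a ≤? k
... | yes _ = V (suc a)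
... | no _ = W (suc a ∸ k)

data LabelOf (k : ℕ) : ℕ → Role → Set where
  label-U : LabelOf k 0 U
  label-V : ∀ {i} → 1 ≤ i → i ≤ k → LabelOf k i (V i)
  label-W : ∀ {j} → 1 ≤ j → LabelOf k (j + k) (W j)

labelOf : ∀ k a → LabelOf k a (role k a)
labelOf k zero = label-U
labelOf k (suc a) with suc a ≤? k
... | yes a<k = label-V (s≤s z≤n) a<k
... | no a≮k = subst (λ b → LabelOf k b (W (suc a ∸ k))) (m∸n+n≡m (<⇒≤ k<a)) (label-W (m<n⇒0<n∸m k<a))
  where k<a = ≰⇒> a≮k

LabelOf⇒role≡ : ∀ {k a r} → LabelOf k a r → role k a ≡ r
LabelOf⇒role≡ label-U = refl
LabelOf⇒role≡ {k} (label-V {suc i} _ i<k) with suc i ≤? k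
... | yes _ = refl
... | no i≮k = contradiction i<k i≮k
LabelOf⇒role≡ {k} (label-W {suc j} _) with suc (j + k) ≤? k
... | yes j+k<k = contradiction j+k<k (<⇒≱ (s≤s (m≤n+m k j)))
... | no _ = cong W (m+n∸n≡m (suc j) k)

LabelOf-injective : ∀ {k a b r} → LabelOf k a r → LabelOf k b r → a ≡ b
LabelOf-injective label-U label-U = refl
LabelOf-injective (label-V _ _) (label-V _ _) = refl
LabelOf-injective (label-W _) (label-W _) = refl

role-injective : ∀ k {a b} → role k a ≡ role k b → a ≡ b
role-injective k {a} {b} eq = LabelOf-injective (labelOf k a) (subst (LabelOf k b) (sym eq) (labelOf k b))

LabelOf-W : ∀ {k a j} → LabelOf k a (W j) → a ≡ j + k × 1 ≤ j
LabelOf-W (label-W 1≤j) = refl , 1≤j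

LabelOf-V : ∀ {k a i} → LabelOf k a (V i) → a ≡ i × 1 ≤ i × i ≤ k
LabelOf-V (label-V 1≤i i≤k) = refl , 1≤i , i≤k

data IsV : Role → Set where
  isV : ∀ i → IsV (V i)

data IsW : Role → Set where
  isW : ∀ j → IsW (W j)

W-injective : ∀ {i j} → W i ≡ W j → i ≡ j
W-injective refl = refl

V≢W : ∀ {i j} → V i ≢ W j
V≢W ()

V≢U : ∀ {i} → V i ≢ U
V≢U ()

W≢U : ∀ {j} → W j ≢ U
W≢U ()

IsV-leg : ∀ {r} → IsV r → ∃ λ i → r ≡ V i
IsV-leg (isV i) = i , refl

IsW-leg : ∀ {r} → IsW r → ∃ λ j → r ≡ W j
IsW-leg (isW j) = j , refl

V-not-W : ∀ {i} → ¬ IsW (V i)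
V-not-W ()

LabelOf-above : ∀ {k a r} → LabelOf k a r → k < a → IsW r
LabelOf-above label-U ()
LabelOf-above (label-V _ i≤k) k<i = contradiction i≤k (<⇒≱ k<i)
LabelOf-above (label-W {j} _) _ = isW j

roleDist : Role → Role → ℕ
roleDist U U = 0
roleDist U (V _) = 1
roleDist U (W _) = 2
roleDist (V _) U = 1
roleDist (W _) U = 2
roleDist (V i) (V j) = if i ≡ᵇ j then 0 else 2
roleDist (V i) (W j) = if i ≡ᵇ j then 1 else 3
roleDist (W i) (V j) = if i ≡ᵇ j then 1 else 3
roleDist (W i) (W j) = if i ≡ᵇ j then 0 else 4

roleDist-refl : ∀ r → roleDist r r ≡ 0
roleDist-refl U = refl
roleDist-refl (V i) rewrite ≡ᵇ-refl i = refl
roleDist-refl (W j) rewrite ≡ᵇ-refl j = refl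

roleDist-sym : ∀ r s → roleDist r s ≡ roleDist s r
roleDist-sym U U = refl
roleDist-sym U (V _) = refl
roleDist-sym U (W _) = refl
roleDist-sym (V _) U = refl
roleDist-sym (W _) U = refl
roleDist-sym (V i) (V j) rewrite ≡ᵇ-sym i j = refl
roleDist-sym (V i) (W j) rewrite ≡ᵇ-sym i j = refl
roleDist-sym (W i) (V j) rewrite ≡ᵇ-sym i j = refl
roleDist-sym (W i) (W j) rewrite ≡ᵇ-sym i j = refl

data Adjacent : Role → Role → Set where
  U-V : ∀ i → Adjacent U (V i)
  V-U : ∀ i → Adjacent (V i) U
  V-W : ∀ j → Adjacent (V j) (W j)
  W-V : ∀ j → Adjacent (W j) (V j)

Adjacent-sym : ∀ {r s} → Adjacent r s → Adjacent s r
Adjacent-sym (U-V i) = V-U i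
Adjacent-sym (V-U i) = U-V i
Adjacent-sym (V-W j) = W-V j
Adjacent-sym (W-V j) = V-W j

Adjacent⇒roleDist≡1 : ∀ {r s} → Adjacent r s → roleDist r s ≡ 1
Adjacent⇒roleDist≡1 (U-V i) = refl
Adjacent⇒roleDist≡1 (V-U i) = refl
Adjacent⇒roleDist≡1 (V-W j) rewrite ≡ᵇ-refl j = refl
Adjacent⇒roleDist≡1 (W-V j) rewrite ≡ᵇ-refl j = refl

roleDist≡1⇒Adjacent : ∀ r s → roleDist r s ≡ 1 → Adjacent r s
roleDist≡1⇒Adjacent U (V i) _ = U-V i
roleDist≡1⇒Adjacent (V i) U _ = V-U i
roleDist≡1⇒Adjacent (V i) (V j) d≡1 with i ≡ᵇ j
... | true = contradiction d≡1 λ ()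
... | false = contradiction d≡1 λ ()
roleDist≡1⇒Adjacent (V i) (W j) d≡1 with i ≟ j
... | yes refl = V-W i
... | no i≢j rewrite ≢⇒≡ᵇ-false i≢j = contradiction d≡1 λ ()
roleDist≡1⇒Adjacent (W i) (V j) d≡1 with i ≟ j
... | yes refl = W-V i
... | no i≢j rewrite ≢⇒≡ᵇ-false i≢j = contradiction d≡1 λ ()
roleDist≡1⇒Adjacent (W i) (W j) d≡1 with i ≡ᵇ j
... | true = contradiction d≡1 λ ()
... | false = contradiction d≡1 λ ()

roleDist-triangle : ∀ {r s} → Adjacent r s → ∀ t → roleDist r t ≤ suc (roleDist s t)
roleDist-triangle (U-V i) U = z≤n
roleDist-triangle (U-V i) (V j) = s≤s z≤n
roleDist-triangle (U-V i) (W j) with i ≡ᵇ j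
... | true = s≤s (s≤s z≤n)
... | false = s≤s (s≤s z≤n)
roleDist-triangle (V-U i) U = s≤s z≤n
roleDist-triangle (V-U i) (V j) with i ≡ᵇ j
... | true = z≤n
... | false = ≤-refl
roleDist-triangle (V-U i) (W j) with i ≡ᵇ j
... | true = s≤s z≤n
... | false = ≤-refl
roleDist-triangle (V-W j) U = s≤s z≤n
roleDist-triangle (V-W j) (V l) with j ≡ᵇ l
... | true = z≤n
... | false = s≤s (s≤s z≤n)
roleDist-triangle (V-W j) (W l) with j ≡ᵇ l
... | true = s≤s z≤n
... | false = s≤s (s≤s (s≤s z≤n))
roleDist-triangle (W-V j) U = ≤-refl
roleDist-triangle (W-V j) (V l) with j ≡ᵇ l
... | true = s≤s z≤n
... | false = s≤s (s≤s (s≤s z≤n))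
roleDist-triangle (W-V j) (W l) with j ≡ᵇ l
... | true = z≤n
... | false = s≤s (s≤s (s≤s (s≤s z≤n)))

roleDist-via-U : ∀ r s → r ≢ s → ¬ Adjacent r s → roleDist r s ≡ roleDist r U + roleDist U s
roleDist-via-U U U r≢s _ = contradiction refl r≢s
roleDist-via-U U (V _) _ _ = refl
roleDist-via-U U (W _) _ _ = refl
roleDist-via-U (V _) U _ _ = refl
roleDist-via-U (W _) U _ _ = refl
roleDist-via-U (V i) (V j) r≢s _ with i ≟ j
... | yes refl = contradiction refl r≢s
... | no i≢j rewrite ≢⇒≡ᵇ-false i≢j = refl
roleDist-via-U (V i) (W j) _ ¬adj with i ≟ j
... | yes refl = contradiction (V-W i) ¬adj
... | no i≢j rewrite ≢⇒≡ᵇ-false i≢j = refl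
roleDist-via-U (W i) (V j) _ ¬adj with i ≟ j
... | yes refl = contradiction (W-V i) ¬adj
... | no i≢j rewrite ≢⇒≡ᵇ-false i≢j = refl
roleDist-via-U (W i) (W j) r≢s _ with i ≟ j
... | yes refl = contradiction refl r≢s
... | no i≢j rewrite ≢⇒≡ᵇ-false i≢j = refl

Adjacent-W-unique : ∀ {r r′ s} → IsW r → IsW r′ → Adjacent r s → Adjacent r′ s → r ≡ r′
Adjacent-W-unique (isW _) (isW _) (W-V _) (W-V _) = refl

¬Adjacent-W-W : ∀ {r s} → IsW r → IsW s → ¬ Adjacent r s
¬Adjacent-W-W (isW _) (isW _) ()

Adjacent-to-W : ∀ {r j} → Adjacent r (W j) → r ≡ V j
Adjacent-to-W (V-W _) = refl

roleDist-W-changed : ∀ {r₁ r₂} → IsW r₁ → IsW r₂ → ∀ s →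
                     roleDist r₁ s ≢ 1 → roleDist r₁ s ≢ roleDist r₂ s →
                     s ≡ r₁ ⊎ s ≡ r₂ ⊎ Adjacent r₂ s
roleDist-W-changed (isW i) (isW j) U _ d≢d′ = contradiction refl d≢d′
roleDist-W-changed (isW i) (isW j) (V l) d≢1 d≢d′ with i ≟ l | j ≟ l
... | yes refl | _ rewrite ≡ᵇ-refl i = contradiction refl d≢1
... | no _ | yes refl = inj₂ (inj₂ (W-V j))
... | no i≢l | no j≢l rewrite ≢⇒≡ᵇ-false i≢l | ≢⇒≡ᵇ-false j≢l = contradiction refl d≢d′
roleDist-W-changed (isW i) (isW j) (W l) _ d≢d′ with i ≟ l | j ≟ l
... | yes refl | _ = inj₁ refl
... | no _ | yes refl = inj₂ (inj₁ refl)
... | no i≢l | no j≢l rewrite ≢⇒≡ᵇ-false i≢l | ≢⇒≡ᵇ-false j≢l = contradiction refl d≢d′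

roleDist-U≤2 : ∀ r → roleDist U r ≤ 2
roleDist-U≤2 U = z≤n
roleDist-U≤2 (V _) = s≤s z≤n
roleDist-U≤2 (W _) = ≤-refl

roleDist-U≡1 : ∀ r → roleDist U r ≡ 1 → IsV r
roleDist-U≡1 (V i) _ = isV i

roleDist-U≡2 : ∀ r → roleDist U r ≡ 2 → IsW r
roleDist-U≡2 (W j) _ = isW j

roleDist-V≢4 : ∀ i r → roleDist (V i) r ≢ 4
roleDist-V≢4 i U ()
roleDist-V≢4 i (V j) with i ≡ᵇ j
... | true = λ ()
... | false = λ ()
roleDist-V≢4 i (W j) with i ≡ᵇ j
... | true = λ ()
... | false = λ ()

roleDist-other-leg : ∀ {i j} → i ≢ j → roleDist (V i) (W j) ≡ 3 × roleDist (W i) (W j) ≡ 4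
roleDist-other-leg i≢j rewrite ≢⇒≡ᵇ-false i≢j = refl , refl

-- The number of profiles find-root spends from a vertex of role r: it moves from
-- a v to u or to a w, and from a w to u.
rounds : Role → ℕ
rounds U = 1
rounds (V _) = 3
rounds (W _) = 2

rounds-decrease : ∀ r s → r ≢ U → roleDist r s ≡ roleDist r U → rounds s < rounds r
rounds-decrease U _ r≢U _ = contradiction refl r≢U
rounds-decrease (V i) U _ _ = s≤s (s≤s z≤n)
rounds-decrease (V i) (V j) _ eq with i ≡ᵇ j
... | true = contradiction eq λ ()
... | false = contradiction eq λ ()
rounds-decrease (V i) (W j) _ _ = ≤-refl
rounds-decrease (W j) U _ _ = ≤-refl
rounds-decrease (W j) (V l) _ eq with j ≡ᵇ l
... | true = contradiction eq λ ()
... | false = contradiction eq λ ()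
rounds-decrease (W j) (W l) _ eq with j ≡ᵇ l
... | true = contradiction eq λ ()
... | false = contradiction eq λ ()

rounds-positive : ∀ r → 0 < rounds r
rounds-positive U = s≤s z≤n
rounds-positive (V _) = s≤s z≤n
rounds-positive (W _) = s≤s z≤n

rounds≤3 : ∀ r → rounds r ≤ 3
rounds≤3 U = s≤s z≤n
rounds≤3 (V _) = ≤-refl
rounds≤3 (W _) = s≤s (s≤s z≤n)

data SpiderEdge (k : ℕ) : ℕ → ℕ → Set where
  u-v : ∀ {i} → 1 ≤ i → i ≤ k → SpiderEdge k 0 i
  v-w : ∀ {i} → 1 ≤ i → i ≤ k → SpiderEdge k i (i + k)

spiderEdgeℕ-sound : ∀ k a b → T (spiderEdgeℕ k a b) → SpiderEdge k a b
spiderEdgeℕ-sound k a b e with to (T-∨ {(a ≡ᵇ 0) ∧ ((1 ≤ᵇ b) ∧ (b ≤ᵇ k))}) e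
... | inj₁ e₁ with to (T-∧ {a ≡ᵇ 0}) e₁
...   | a≡0 , e₂ with to (T-∧ {1 ≤ᵇ b}) e₂
...     | 1≤b , b≤k with ≡ᵇ⇒≡ a 0 a≡0
...       | refl = u-v (≤ᵇ⇒≤ 1 b 1≤b) (≤ᵇ⇒≤ b k b≤k)
spiderEdgeℕ-sound k a b e | inj₂ e₁ with to (T-∧ {(1 ≤ᵇ a) ∧ (a ≤ᵇ k)}) e₁
...   | e₂ , b≡a+k with to (T-∧ {1 ≤ᵇ a}) e₂
...     | 1≤a , a≤k with ≡ᵇ⇒≡ b (a + k) b≡a+k
...       | refl = v-w (≤ᵇ⇒≤ 1 a 1≤a) (≤ᵇ⇒≤ a k a≤k)

SpiderEdge⇒Adjacent : ∀ {k a b} → SpiderEdge k a b → Adjacent (role k a) (role k b)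
SpiderEdge⇒Adjacent {k} (u-v {i} 1≤i i≤k) rewrite LabelOf⇒role≡ (label-V 1≤i i≤k) = U-V i
SpiderEdge⇒Adjacent {k} (v-w {i} 1≤i i≤k)
  rewrite LabelOf⇒role≡ (label-V 1≤i i≤k) | LabelOf⇒role≡ {k} (label-W 1≤i) = V-W i

spiderEdgeℕ-complete : ∀ {k a b} → SpiderEdge k a b → T (spiderEdgeℕ k a b)
spiderEdgeℕ-complete {k} (u-v {i} 1≤i i≤k) =
  from (T-∨ {(1 ≤ᵇ i) ∧ (i ≤ᵇ k)}) (inj₁ (from (T-∧ {1 ≤ᵇ i}) (≤⇒≤ᵇ 1≤i , ≤⇒≤ᵇ i≤k)))
spiderEdgeℕ-complete {k} {a} (v-w 1≤a a≤k) =
  from (T-∨ {(a ≡ᵇ 0) ∧ ((1 ≤ᵇ a + k) ∧ (a + k ≤ᵇ k))})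
       (inj₂ (from (T-∧ {(1 ≤ᵇ a) ∧ (a ≤ᵇ k)})
               (from (T-∧ {1 ≤ᵇ a}) (≤⇒≤ᵇ 1≤a , ≤⇒≤ᵇ a≤k) , ≡⇒≡ᵇ (a + k) (a + k) refl)))

Adjacent⇒SpiderEdge : ∀ {k a b r s} → LabelOf k a r → LabelOf k b s → Adjacent r s →
                      SpiderEdge k a b ⊎ SpiderEdge k b a
Adjacent⇒SpiderEdge label-U (label-V 1≤b b≤k) (U-V _) = inj₁ (u-v 1≤b b≤k)
Adjacent⇒SpiderEdge (label-V 1≤a a≤k) label-U (V-U _) = inj₂ (u-v 1≤a a≤k)
Adjacent⇒SpiderEdge (label-V 1≤a a≤k) (label-W _) (V-W _) = inj₁ (v-w 1≤a a≤k)
Adjacent⇒SpiderEdge (label-W _) (label-V 1≤b b≤k) (W-V _) = inj₂ (v-w 1≤b b≤k)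

module Spider (m : ℕ) where

  n : ℕ
  n = suc m

  k : ℕ
  k = ⌊ n /2⌋

  k<n : k < n
  k<n = ⌊n/2⌋<n m

  G : Graph n
  G = spider n

  roleOf : Fin n → Role
  roleOf s = role k (toℕ s)

  roleOf-injective : ∀ {s t} → roleOf s ≡ roleOf t → s ≡ t
  roleOf-injective eq = toℕ-injective (role-injective k eq)

  δ : Fin n → Fin n → ℕ
  δ s t = roleDist (roleOf s) (roleOf t)

  edge⇒Adjacent : ∀ s t → T (G s t) → Adjacent (roleOf s) (roleOf t)
  edge⇒Adjacent s t e with to (T-∨ {spiderEdgeℕ k (toℕ s) (toℕ t)}) e
  ... | inj₁ e′ = SpiderEdge⇒Adjacent (spiderEdgeℕ-sound k (toℕ s) (toℕ t) e′)
  ... | inj₂ e′ = Adjacent-sym (SpiderEdge⇒Adjacent (spiderEdgeℕ-sound k (toℕ t) (toℕ s) e′))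

  Adjacent⇒edge : ∀ s t → Adjacent (roleOf s) (roleOf t) → T (G s t)
  Adjacent⇒edge s t adj with Adjacent⇒SpiderEdge (labelOf k (toℕ s)) (labelOf k (toℕ t)) adj
  ... | inj₁ e = from (T-∨ {spiderEdgeℕ k (toℕ s) (toℕ t)}) (inj₁ (spiderEdgeℕ-complete e))
  ... | inj₂ e = from (T-∨ {spiderEdgeℕ k (toℕ s) (toℕ t)}) (inj₂ (spiderEdgeℕ-complete e))

  edge-sym : ∀ {s t} → T (G s t) → T (G t s)
  edge-sym {s} {t} e = Adjacent⇒edge t s (Adjacent-sym (edge⇒Adjacent s t e))

  root : Fin n
  root = zero

  vertex-V : ∀ {i} → 1 ≤ i → i ≤ k → ∃ λ p → roleOf p ≡ V i
  vertex-V 1≤i i≤k = fromℕ< (≤-<-trans i≤k k<n) ,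
                     trans (cong (role k) (toℕ-fromℕ< (≤-<-trans i≤k k<n))) (LabelOf⇒role≡ (label-V 1≤i i≤k))

  vertex-W : ∀ {j} → 1 ≤ j → j + k < n → ∃ λ p → roleOf p ≡ W j
  vertex-W 1≤j j+k<n = fromℕ< j+k<n , trans (cong (role k) (toℕ-fromℕ< j+k<n)) (LabelOf⇒role≡ (label-W 1≤j))

  W-leg-bounds : ∀ s {j} → roleOf s ≡ W j → 1 ≤ j × j ≤ k
  W-leg-bounds s eq with LabelOf-W (subst (LabelOf k (toℕ s)) eq (labelOf k (toℕ s)))
  ... | s≡j+k , 1≤j = 1≤j , +-cancelʳ-≤ k _ _ j+k≤k+k
    where
    j+k≤k+k = ≤-trans (≤-reflexive (sym s≡j+k)) (≤-pred (≤-trans (toℕ<n s) (half-upper n)))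

  partner : ∀ s {j} → roleOf s ≡ W j → ∃ λ p → roleOf p ≡ V j
  partner s eq = vertex-V (proj₁ (W-leg-bounds s eq)) (proj₂ (W-leg-bounds s eq))

  walk-to-root : ∀ s → Walk G s root (roleDist (roleOf s) U)
  walk-to-root s with roleOf s in eq
  ... | U = subst (λ x → Walk G x root 0) (sym (roleOf-injective eq)) here
  ... | V i = step {y = root} (Adjacent⇒edge s root (subst (λ r → Adjacent r U) (sym eq) (V-U i))) here
  ... | W j with partner s eq
  ...   | p , p-V = step {y = p} (Adjacent⇒edge s p (subst₂ Adjacent (sym eq) (sym p-V) (W-V j)))
                         (step {y = root} (Adjacent⇒edge p root (subst (λ r → Adjacent r U) (sym p-V) (V-U j))) here)

  shortest-walk : ∀ s t → Walk G s t (δ s t)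
  shortest-walk s t with s ≟ᶠ t
  ... | yes refl = subst (Walk G s s) (sym (roleDist-refl (roleOf s))) here
  ... | no s≢t with δ s t ≟ 1
  ...   | yes δ≡1 = subst (Walk G s t) (sym δ≡1)
                      (step {y = t} (Adjacent⇒edge s t (roleDist≡1⇒Adjacent _ _ δ≡1)) here)
  ...   | no δ≢1 = subst (Walk G s t) (sym via-root)
                     (walk-to-root s ++ʷ subst (Walk G root t) (roleDist-sym (roleOf t) U)
                                                (reverseʷ (λ {x} {y} → edge-sym {x} {y}) (walk-to-root t)))
    where
    via-root = roleDist-via-U (roleOf s) (roleOf t) (λ eq → s≢t (roleOf-injective eq))
                              (λ adj → δ≢1 (Adjacent⇒roleDist≡1 adj))

  walk-length-bound : ∀ {s t L} → Walk G s t L → δ s t ≤ L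
  walk-length-bound {s} here = ≤-reflexive (roleDist-refl (roleOf s))
  walk-length-bound {s} {t} (step {y = y} e w) =
    ≤-trans (roleDist-triangle (edge⇒Adjacent s y e) (roleOf t)) (s≤s (walk-length-bound w))

  roleIn : Permutation′ n → Fin n → Role
  roleIn π x = roleOf (π ⟨$⟩ˡ x)

  roleIn-injective : ∀ π {x y} → roleIn π x ≡ roleIn π y → x ≡ y
  roleIn-injective π {x} {y} eq =
    trans (sym (inverseʳ π)) (trans (cong (π ⟨$⟩ʳ_) (roleOf-injective eq)) (inverseʳ π))

  Δ : Permutation′ n → Fin n → Fin n → ℕ
  Δ π x y = roleDist (roleIn π x) (roleIn π y)

  Δ-sym : ∀ π x y → Δ π x y ≡ Δ π y x
  Δ-sym π x y = roleDist-sym (roleIn π x) (roleIn π y)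

  copy-dist : ∀ π x y → Dist (copy π) x y (Δ π x y)
  copy-dist π x y =
    subst₂ (λ a b → Walk (copy π) a b (Δ π x y)) (inverseʳ π) (inverseʳ π)
           (mapʷ (π ⟨$⟩ʳ_) to-copy (shortest-walk (π ⟨$⟩ˡ x) (π ⟨$⟩ˡ y)))
    , λ L w → walk-length-bound (mapʷ (π ⟨$⟩ˡ_) (λ e → e) w)
    where
    to-copy : ∀ {s t} → T (G s t) → T (copy π (π ⟨$⟩ʳ s) (π ⟨$⟩ʳ t))
    to-copy = subst T (sym (cong₂ G (inverseˡ π) (inverseˡ π)))

  Agrees : Permutation′ n → Answer n → Set
  Agrees π a = Answer.dist a ≡ Δ π (Answer.qx a) (Answer.qy a)

  Consistent⇒Agrees : ∀ π {as} → Consistent π as → All (Agrees π) as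
  Consistent⇒Agrees π = All.map λ {a} d → Dist-unique d (copy-dist π (Answer.qx a) (Answer.qy a))

  Agrees⇒Consistent : ∀ π {as} → All (Agrees π) as → Consistent π as
  Agrees⇒Consistent π = All.map λ {a} eq → subst (Dist (copy π) _ _) (sym eq) (copy-dist π (Answer.qx a) (Answer.qy a))

  vertexIn : ∀ π {r} → (∃ λ p → roleOf p ≡ r) → ∃ λ x → roleIn π x ≡ r
  vertexIn π (p , p-r) = π ⟨$⟩ʳ p , trans (cong roleOf (inverseˡ π)) p-r

  partnerIn : ∀ π x {j} → roleIn π x ≡ W j → ∃ λ p → roleIn π p ≡ V j
  partnerIn π x eq = vertexIn π (partner (π ⟨$⟩ˡ x) eq)

  V-vertices : Permutation′ n → List (Fin n)
  V-vertices ρ = map (λ i → ρ ⟨$⟩ʳ label i) (allFin k)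
    where label : Fin k → Fin n
          label i = fromℕ< (≤-trans (s≤s (toℕ<n i)) k<n)

  V∈V-vertices : ∀ ρ {x i} → roleIn ρ x ≡ V i → x ∈ V-vertices ρ
  V∈V-vertices ρ {x} x-V with LabelOf-V (subst (LabelOf k _) x-V (labelOf k (toℕ (ρ ⟨$⟩ˡ x))))
  ... | x≡i , s≤s z≤n , i≤k =
    subst (_∈ V-vertices ρ) (trans (cong (ρ ⟨$⟩ʳ_) label≡x) (inverseʳ ρ))
          (∈-map⁺ _ (∈-allFin (fromℕ< i≤k)))
    where
    label≡x : fromℕ< (≤-trans (s≤s (toℕ<n (fromℕ< i≤k))) k<n) ≡ ρ ⟨$⟩ˡ x
    label≡x = toℕ-injective (trans (toℕ-fromℕ< (≤-trans (s≤s (toℕ<n (fromℕ< i≤k))) k<n))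
                                   (trans (cong suc (toℕ-fromℕ< i≤k)) (sym x≡i)))

  V-count : ∀ ρ {xs} → Unique xs → (∀ {x} → x ∈ xs → IsV (roleIn ρ x)) → length xs ≤ k
  V-count ρ {xs} u xs-V = ≤-trans (Unique-⊆-length u (λ x∈ → V∈ (xs-V x∈)))
                                  (≤-reflexive (trans (length-map _ (allFin k)) (length-tabulate _)))
    where
    V∈ : ∀ {x} → IsV (roleIn ρ x) → x ∈ V-vertices ρ
    V∈ {x} x-V with IsV-leg x-V
    ... | i , eq = V∈V-vertices ρ eq

module LowerBound (m : ℕ) where
  open Spider m

  FixesUV : Permutation′ n → Set
  FixesUV π = ∀ a → toℕ a ≤ k → π ⟨$⟩ˡ a ≡ a

  Realisable : List (Answer n) → Set
  Realisable as = ∃ λ π → FixesUV π × All (Agrees π) as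

  Forced : List (Answer n) → Answer n → Set
  Forced as a = ∀ π → FixesUV π → All (Agrees π) as → Δ π (Answer.qx a) (Answer.qy a) ≡ 1

  AdversaryHistory : List (Answer n) → Set
  AdversaryHistory [] = ⊤
  AdversaryHistory (a ∷ as) = AdversaryHistory as × (Answer.dist a ≢ 1 ⊎ Forced as a)

  Outcome : ℕ → List (Answer n) → Set
  Outcome q as = ∃ λ bs → AdversaryHistory bs × Determined bs × Realisable bs × length bs ≤ length as + q

  adversary : ∀ {q as} → Solves q as → AdversaryHistory as → Realisable as → ¬ ¬ Outcome q as
  adversary {as = as} (stop det) h r = pure (as , h , det , r , m≤m+n _ _)
  adversary {suc q} {as} (query x y _ next) h (π , fixes , agrees) = ¬¬-excluded-middle {A = Deviation} >>= λ where
      (yes (π₀ , fixes₀ , agrees₀ , d≢1)) →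
        shift {Δ π₀ x y} <$> adversary (next (Δ π₀ x y)) (h , inj₁ d≢1) (π₀ , fixes₀ , refl ∷ agrees₀)
      (no none) →
        shift {Δ π x y} <$> adversary (next (Δ π x y)) (h , inj₂ (forced none)) (π , fixes , refl ∷ agrees)
    where
    shift : ∀ {d} → Outcome q (⟨ x , y ↦ d ⟩ ∷ as) → Outcome (suc q) as
    shift (bs , h , det , r , len) = bs , h , det , r , ≤-trans len (≤-reflexive (sym (+-suc _ q)))
    Deviation = ∃ λ π₀ → FixesUV π₀ × All (Agrees π₀) as × Δ π₀ x y ≢ 1
    forced : ¬ Deviation → Forced as ⟨ x , y ↦ Δ π x y ⟩
    forced none π₀ fixes₀ agrees₀ =
      decidable-stable (Δ π₀ x y ≟ 1) λ d≢1 → none (π₀ , fixes₀ , agrees₀ , d≢1)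

  fixed-point : ∀ {π} → FixesUV π → ∀ y → toℕ (π ⟨$⟩ˡ y) ≤ k → π ⟨$⟩ˡ y ≡ y
  fixed-point {π} fixes y ≤k =
    trans (sym (inverseʳ π)) (trans (cong (π ⟨$⟩ʳ_) (fixes (π ⟨$⟩ˡ y) ≤k)) (inverseʳ π))

  slot-W : ∀ {π} → FixesUV π → ∀ {x} → k < toℕ x → IsW (roleIn π x)
  slot-W {π} fixes {x} k<x with toℕ (π ⟨$⟩ˡ x) ≤? k
  ... | yes ≤k = contradiction (subst (λ y → toℕ y ≤ k) (fixed-point {π} fixes x ≤k) ≤k) (<⇒≱ k<x)
  ... | no ≰k = LabelOf-above (labelOf k _) (≰⇒> ≰k)

  Splits : Permutation′ n → Fin n → Fin n → Fin n → Fin n → Set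
  Splits π e f x y = e ≡ x × Adjacent (roleIn π y) (roleIn π f)

  Splits-unique : ∀ {π e f x x′ y y′} → IsW (roleIn π y) → IsW (roleIn π y′) →
                  Splits π e f x y → Splits π e f x′ y′ → x ≡ x′ × y ≡ y′
  Splits-unique {π} y-W y′-W (refl , adj) (refl , adj′) =
    refl , roleIn-injective π (Adjacent-W-unique y-W y′-W adj adj′)

  Separates : Permutation′ n → Fin n → Fin n → Fin n → Fin n → Set
  Separates π x₁ x₂ e f = Splits π e f x₁ x₂ ⊎ Splits π e f x₂ x₁

  SeparatedBy : Permutation′ n → Fin n → Fin n → Answer n → Set
  SeparatedBy π x₁ x₂ a =
    Separates π x₁ x₂ (Answer.qx a) (Answer.qy a) ⊎ Separates π x₁ x₂ (Answer.qy a) (Answer.qx a)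

  module _ {π : Permutation′ n} {x₁ x₂ y₁ y₂ : Fin n}
           (x₁-W : IsW (roleIn π x₁)) (x₂-W : IsW (roleIn π x₂))
           (y₁-W : IsW (roleIn π y₁)) (y₂-W : IsW (roleIn π y₂)) where

    Separates-unique : ∀ {e f} → Separates π x₁ x₂ e f → Separates π y₁ y₂ e f →
                       (x₁ ≡ y₁ × x₂ ≡ y₂) ⊎ (x₁ ≡ y₂ × x₂ ≡ y₁)
    Separates-unique (inj₁ s) (inj₁ t) = inj₁ (Splits-unique {π} x₂-W y₂-W s t)
    Separates-unique (inj₁ s) (inj₂ t) = inj₂ (Splits-unique {π} x₂-W y₁-W s t)
    Separates-unique (inj₂ s) (inj₁ t) = inj₂ (Product.swap (Splits-unique {π} x₁-W y₂-W s t))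
    Separates-unique (inj₂ s) (inj₂ t) = inj₁ (Product.swap (Splits-unique {π} x₁-W y₁-W s t))

    Separates-not-flipped : ∀ {e f} → Separates π x₁ x₂ e f → ¬ Separates π y₁ y₂ f e
    Separates-not-flipped (inj₁ (refl , _)) (inj₁ (_ , adj)) = ¬Adjacent-W-W y₂-W x₁-W adj
    Separates-not-flipped (inj₁ (refl , _)) (inj₂ (_ , adj)) = ¬Adjacent-W-W y₁-W x₁-W adj
    Separates-not-flipped (inj₂ (refl , _)) (inj₁ (_ , adj)) = ¬Adjacent-W-W y₂-W x₂-W adj
    Separates-not-flipped (inj₂ (refl , _)) (inj₂ (_ , adj)) = ¬Adjacent-W-W y₁-W x₂-W adj

    SeparatedBy-unique : ∀ {a} → SeparatedBy π x₁ x₂ a → SeparatedBy π y₁ y₂ a →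
                         (x₁ ≡ y₁ × x₂ ≡ y₂) ⊎ (x₁ ≡ y₂ × x₂ ≡ y₁)
    SeparatedBy-unique (inj₁ s) (inj₁ t) = Separates-unique s t
    SeparatedBy-unique (inj₂ s) (inj₂ t) = Separates-unique s t
    SeparatedBy-unique (inj₁ s) (inj₂ t) = contradiction t (Separates-not-flipped s)
    SeparatedBy-unique (inj₂ s) (inj₁ t) = contradiction t (Separates-not-flipped s)

  module Swap {π : Permutation′ n} (fixes : FixesUV π) {x₁ x₂ : Fin n}
              (k<x₁ : k < toℕ x₁) (k<x₂ : k < toℕ x₂) (x₁≢x₂ : x₁ ≢ x₂) where

    τ : Fin n → Fin n
    τ = PC.transpose x₁ x₂

    swapped : Permutation′ n
    swapped = π ∘ₚ transpose x₂ x₁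

    swapped-fixesUV : FixesUV swapped
    swapped-fixesUV a a≤k = trans (cong (π ⟨$⟩ˡ_) (transpose-other (below k<x₁) (below k<x₂))) (fixes a a≤k)
      where
      below : ∀ {x} → k < toℕ x → a ≢ x
      below k<x refl = <⇒≱ k<x a≤k

    x₁-W : IsW (roleIn π x₁)
    x₁-W = slot-W {π} fixes k<x₁

    x₂-W : IsW (roleIn π x₂)
    x₂-W = slot-W {π} fixes k<x₂

    data Place (x : Fin n) : Set where
      at₁ : x ≡ x₁ → Place x
      at₂ : x ≡ x₂ → Place x
      off : x ≢ x₁ → x ≢ x₂ → Place x

    place : ∀ x → Place x
    place x with x ≟ᶠ x₁ | x ≟ᶠ x₂
    ... | yes x≡x₁ | _ = at₁ x≡x₁
    ... | no _ | yes x≡x₂ = at₂ x≡x₂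
    ... | no x≢x₁ | no x≢x₂ = off x≢x₁ x≢x₂

    -- swapped ⟨$⟩ˡ y reduces to π ⟨$⟩ˡ τ y.
    Δ-swapped : ∀ x y {x′ y′} → τ x ≡ x′ → τ y ≡ y′ → Δ swapped x y ≡ Δ π x′ y′
    Δ-swapped x y = cong₂ (Δ π)

    Δ-diagonal : ∀ x → Δ π x x ≡ Δ swapped x x
    Δ-diagonal x = trans (roleDist-refl (roleIn π x)) (sym (roleDist-refl (roleIn swapped x)))

    ≢1-sym : ∀ {x y} → Δ π x y ≢ 1 → Δ π y x ≢ 1
    ≢1-sym {x} {y} d≢1 eq = d≢1 (trans (Δ-sym π x y) eq)

    disagrees-sym : ∀ {x y} → Δ π x y ≢ Δ swapped x y → Δ π y x ≢ Δ swapped y x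
    disagrees-sym {x} {y} d≢d′ eq = d≢d′ (trans (Δ-sym π x y) (trans eq (Δ-sym swapped y x)))

    moved-endpoint : ∀ {xa xb y} → IsW (roleIn π xa) → IsW (roleIn π xb) → τ xa ≡ xb → τ y ≡ y →
                     y ≢ xa → y ≢ xb → Δ π xa y ≢ 1 → Δ π xa y ≢ Δ swapped xa y →
                     Adjacent (roleIn π xb) (roleIn π y)
    moved-endpoint {xa} {xb} {y} xa-W xb-W τxa τy y≢xa y≢xb d≢1 d≢d′ =
      [ (λ eq → contradiction (roleIn-injective π eq) y≢xa)
      , [ (λ eq → contradiction (roleIn-injective π eq) y≢xb) , (λ adj → adj) ] ]
      (roleDist-W-changed xa-W xb-W (roleIn π y) d≢1 λ eq → d≢d′ (trans eq (sym (Δ-swapped xa y τxa τy))))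

    disagreement-separates : ∀ x y → Δ π x y ≢ 1 → Δ π x y ≢ Δ swapped x y →
                             Separates π x₁ x₂ x y ⊎ Separates π x₁ x₂ y x
    disagreement-separates x y d≢1 d≢d′ with place x | place y
    ... | at₁ refl | at₁ refl = contradiction (Δ-diagonal x₁) d≢d′
    ... | at₂ refl | at₂ refl = contradiction (Δ-diagonal x₂) d≢d′
    ... | at₁ refl | at₂ refl =
      contradiction (trans (Δ-sym π x₁ x₂) (sym (Δ-swapped x₁ x₂ (transpose-ˡ x₁ x₂) (transpose-ʳ x₁ x₂)))) d≢d′
    ... | at₂ refl | at₁ refl =
      contradiction (trans (Δ-sym π x₂ x₁) (sym (Δ-swapped x₂ x₁ (transpose-ʳ x₁ x₂) (transpose-ˡ x₁ x₂)))) d≢d′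
    ... | off x≢x₁ x≢x₂ | off y≢x₁ y≢x₂ =
      contradiction (sym (Δ-swapped x y (transpose-other x≢x₁ x≢x₂) (transpose-other y≢x₁ y≢x₂))) d≢d′
    ... | at₁ refl | off y≢x₁ y≢x₂ = inj₁ (inj₁ (refl ,
      moved-endpoint {x₁} {x₂} {y} x₁-W x₂-W (transpose-ˡ x₁ x₂) (transpose-other y≢x₁ y≢x₂) y≢x₁ y≢x₂ d≢1 d≢d′))
    ... | at₂ refl | off y≢x₁ y≢x₂ = inj₁ (inj₂ (refl ,
      moved-endpoint {x₂} {x₁} {y} x₂-W x₁-W (transpose-ʳ x₁ x₂) (transpose-other y≢x₁ y≢x₂) y≢x₂ y≢x₁ d≢1 d≢d′))
    ... | off x≢x₁ x≢x₂ | at₁ refl = inj₂ (inj₁ (refl ,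
      moved-endpoint {x₁} {x₂} {x} x₁-W x₂-W (transpose-ˡ x₁ x₂) (transpose-other x≢x₁ x≢x₂) x≢x₁ x≢x₂
                     (≢1-sym {x} {x₁} d≢1) (disagrees-sym {x} {x₁} d≢d′)))
    ... | off x≢x₁ x≢x₂ | at₂ refl = inj₂ (inj₂ (refl ,
      moved-endpoint {x₂} {x₁} {x} x₂-W x₁-W (transpose-ʳ x₁ x₂) (transpose-other x≢x₁ x≢x₂) x≢x₂ x≢x₁
                     (≢1-sym {x} {x₂} d≢1) (disagrees-sym {x} {x₂} d≢d′)))

    swapped-disagrees : ∀ {bs} → Determined bs → All (Agrees π) bs → ¬ All (Agrees swapped) bs
    swapped-disagrees det agrees agrees′ with IsW-leg x₁-W
    ... | j , x₁-Wj with partnerIn π x₁ x₁-Wj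
    ...   | p , p-V = x₁≢x₂ (roleIn-injective π (Adjacent-W-unique x₁-W x₂-W adj-π adj-swapped))
      where
      not-slot : ∀ {x} → IsW (roleIn π x) → p ≢ x
      not-slot x-W refl = V-not-W (subst IsW p-V x-W)
      adj-π : Adjacent (roleIn π x₁) (roleIn π p)
      adj-π = subst₂ Adjacent (sym x₁-Wj) (sym p-V) (W-V j)
      same-edge : copy π x₁ p ≡ copy swapped x₁ p
      same-edge = det π swapped (Agrees⇒Consistent π agrees) (Agrees⇒Consistent swapped agrees′) x₁ p
      adj-swapped : Adjacent (roleIn π x₂) (roleIn π p)
      adj-swapped = subst₂ (λ a b → Adjacent (roleIn π a) (roleIn π b))
                           (transpose-ˡ x₁ x₂) (transpose-other (not-slot x₁-W) (not-slot x₂-W))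
                           (edge⇒Adjacent (swapped ⟨$⟩ˡ x₁) (swapped ⟨$⟩ˡ p)
                             (subst T same-edge (Adjacent⇒edge (π ⟨$⟩ˡ x₁) (π ⟨$⟩ˡ p) adj-π)))

    first-disagreement : ∀ {bs} → AdversaryHistory bs → All (Agrees π) bs → ¬ All (Agrees swapped) bs →
                         Any (λ a → Answer.dist a ≢ 1 × Agrees π a × ¬ Agrees swapped a) bs
    first-disagreement {[]} _ [] ¬agrees′ = contradiction [] ¬agrees′
    first-disagreement {a ∷ bs} (h , unforced-or-forced) (agree ∷ agrees) ¬agrees′
      with All.all? (λ b → Answer.dist b ≟ Δ swapped (Answer.qx b) (Answer.qy b)) bs
    ... | no ¬tail = there (first-disagreement h agrees ¬tail)
    ... | yes tail with unforced-or-forced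
    ...   | inj₁ d≢1 = here (d≢1 , agree , λ agree′ → ¬agrees′ (agree′ ∷ tail))
    ...   | inj₂ forced = contradiction (agree′ ∷ tail) ¬agrees′
      where agree′ = trans agree (trans (forced π fixes agrees) (sym (forced swapped swapped-fixesUV tail)))

    separating-answer : ∀ {bs} → AdversaryHistory bs → Determined bs → All (Agrees π) bs →
                        Any (SeparatedBy π x₁ x₂) bs
    separating-answer h det agrees = Any.map separates (first-disagreement h agrees (swapped-disagrees det agrees))
      where
      separates : ∀ {a} → Answer.dist a ≢ 1 × Agrees π a × ¬ Agrees swapped a → SeparatedBy π x₁ x₂ a
      separates {a} (d≢1 , agree , ¬agree′) =
        disagreement-separates (Answer.qx a) (Answer.qy a)
          (λ eq → d≢1 (trans agree eq)) (λ eq → ¬agree′ (trans agree eq))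

  K : ℕ
  K = m ∸ k

  slot-bound : ∀ {s} → s < K → suc (k + s) < n
  slot-bound s<K = s≤s (≤-trans (+-monoʳ-< k s<K) (≤-reflexive (m+[n∸m]≡n (≤-pred k<n))))

  slot : ∀ s → s < K → Fin n
  slot s s<K = fromℕ< (slot-bound s<K)

  slot-label : ∀ s s<K → toℕ (slot s s<K) ≡ suc (k + s)
  slot-label s s<K = toℕ-fromℕ< (slot-bound s<K)

  slot-above : ∀ s s<K → k < toℕ (slot s s<K)
  slot-above s s<K = subst (k <_) (sym (slot-label s s<K)) (s≤s (m≤m+n k s))

  slot-injective : ∀ {s s′} (s<K : s < K) (s′<K : s′ < K) → slot s s<K ≡ slot s′ s′<K → s ≡ s′
  slot-injective {s} {s′} s<K s′<K eq =
    +-cancelˡ-≡ k s s′ (suc-injective (trans (sym (slot-label s s<K)) (trans (cong toℕ eq) (slot-label s′ s′<K))))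

  separated-pairs : ∀ {π} → FixesUV π → ∀ {bs} → AdversaryHistory bs → Determined bs → All (Agrees π) bs →
                    choose2 K ≤ length bs
  separated-pairs {π} fixes {bs} h det agrees = injective⇒≤ index-injective
    where
    i<j : ∀ e → proj₁ (pairAt K e) < proj₂ (pairAt K e)
    i<j e = proj₁ (pairAt-< K e)
    j<K : ∀ e → proj₂ (pairAt K e) < K
    j<K e = proj₂ (pairAt-< K e)
    i<K : ∀ e → proj₁ (pairAt K e) < K
    i<K e = <-trans (i<j e) (j<K e)
    x₁ x₂ : Fin (choose2 K) → Fin n
    x₁ e = slot (proj₁ (pairAt K e)) (i<K e)
    x₂ e = slot (proj₂ (pairAt K e)) (j<K e)
    x₁-above : ∀ e → k < toℕ (x₁ e)
    x₁-above e = slot-above (proj₁ (pairAt K e)) (i<K e)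
    x₂-above : ∀ e → k < toℕ (x₂ e)
    x₂-above e = slot-above (proj₂ (pairAt K e)) (j<K e)
    answer : ∀ e → Any (SeparatedBy π (x₁ e) (x₂ e)) bs
    answer e = Swap.separating-answer {π} fixes {x₁ e} {x₂ e} (x₁-above e) (x₂-above e)
                 (λ eq → <⇒≢ (i<j e) (slot-injective (i<K e) (j<K e) eq))
                 h det agrees
    index : Fin (choose2 K) → Fin (length bs)
    index e = Any.index (answer e)
    index-injective : ∀ {e e′} → index e ≡ index e′ → e ≡ e′
    index-injective {e} {e′} eq = same-pair (SeparatedBy-unique {π} {x₁ e} {x₂ e} {x₁ e′} {x₂ e′}
      (slot-W {π} fixes (x₁-above e)) (slot-W {π} fixes (x₂-above e))
      (slot-W {π} fixes (x₁-above e′)) (slot-W {π} fixes (x₂-above e′))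
      {lookup bs (index e)} (lookup-index (answer e))
      (subst (λ i → SeparatedBy π (x₁ e′) (x₂ e′) (lookup bs i)) (sym eq) (lookup-index (answer e′))))
      where
      same-pair : (x₁ e ≡ x₁ e′ × x₂ e ≡ x₂ e′) ⊎ (x₁ e ≡ x₂ e′ × x₂ e ≡ x₁ e′) → e ≡ e′
      same-pair (inj₁ (eq₁ , eq₂)) =
        pairAt-injective K (cong₂ _,_ (slot-injective (i<K e) (i<K e′) eq₁) (slot-injective (j<K e) (j<K e′) eq₂))
      same-pair (inj₂ (eq₁ , eq₂)) =
        contradiction (subst₂ _<_ (sym (slot-injective (j<K e) (i<K e′) eq₂))
                                  (sym (slot-injective (i<K e) (j<K e′) eq₁)) (i<j e′))
                      (<-asym (i<j e))

  lower-bound : ∀ q → Solves {n} q [] → choose2 K ≤ q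
  lower-bound q solves = decidable-stable (choose2 K ≤? q) (bound <$> adversary solves tt (id , (λ _ _ → refl) , []))
    where
    bound : Outcome q [] → choose2 K ≤ q
    bound (bs , h , det , (π , fixes , agrees) , len) = ≤-trans (separated-pairs {π} fixes h det agrees) len

module UpperBound (m : ℕ) (two-W : 2 + ⌊ suc m /2⌋ < suc m) where
  open Spider m
  open import Data.List.Membership.DecPropositional (_≟ᶠ_ {n}) using (_∈?_)

  give-up : ∀ {q as} → (∀ ρ → ¬ All (Agrees ρ) as) → Solves q as
  give-up none = stop λ π _ cπ _ → ⊥-elim (none π (Consistent⇒Agrees π cπ))

  other-W : ∀ ρ j → ∃ λ z → ∃ λ j′ → roleIn ρ z ≡ W j′ × j′ ≢ j
  other-W ρ j with j ≟ 1
  ... | yes refl = let z , z-W = vertexIn ρ (vertex-W (s≤s z≤n) two-W) in z , 2 , z-W , λ ()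
  ... | no j≢1 = let z , z-W = vertexIn ρ (vertex-W (s≤s z≤n) (<-trans (n<1+n _) two-W)) in
                 z , 1 , z-W , λ eq → j≢1 (sym eq)

  Known : List (Answer n) → Fin n → Fin n → ℕ → Set
  Known bs x y d = ⟨ x , y ↦ d ⟩ ∈ bs

  Profile : List (Answer n) → Fin n → (Fin n → ℕ) → Set
  Profile bs a D = ∀ x → x ≢ a → Known bs a x (D x)

  profile-of : ∀ {q as} a ts →
               (∀ bs → as ⊆ bs → ∀ (D : Fin n → ℕ) → (∀ x → x ∈ ts → x ≢ a → Known bs a x (D x)) →
                Solves q bs) →
               Solves (length ts + q) as
  profile-of {as = as} a [] next = next as (λ a∈ → a∈) (λ _ → 0) λ _ ()
  profile-of {as = as} a (t ∷ ts) next with a ≟ᶠ t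
  ... | yes refl = Solves-mono (n≤1+n _) (profile-of a ts λ bs as⊆bs D known → next bs as⊆bs D λ where
          x (here refl) x≢a → contradiction refl x≢a
          x (there x∈ts) x≢a → known x x∈ts x≢a)
  ... | no a≢t = query a t a≢t λ d → profile-of a ts λ bs as⊆bs D known →
          next bs (λ a∈ → as⊆bs (there a∈)) (updateAt D t (λ _ → d)) (known-t d bs as⊆bs D known)
    where
    known-t : ∀ d bs → ⟨ a , t ↦ d ⟩ ∷ as ⊆ bs → ∀ (D : Fin n → ℕ) →
              (∀ x → x ∈ ts → x ≢ a → Known bs a x (D x)) →
              ∀ x → x ∈ t ∷ ts → x ≢ a → Known bs a x (updateAt D t (λ _ → d) x)
    known-t d bs sub D known x x∈ x≢a with x ≟ᶠ t
    ... | yes refl = subst (Known bs a x) (sym (updateAt-updates x D)) (sub (here refl))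
    ... | no x≢t = subst (Known bs a x) (sym (updateAt-minimal x t D x≢t)) (known x (tail-∈ x∈) x≢a)
      where
      tail-∈ : x ∈ t ∷ ts → x ∈ ts
      tail-∈ (here x≡t) = contradiction x≡t x≢t
      tail-∈ (there x∈ts) = x∈ts

  profile : ∀ {q as} a → (∀ bs → as ⊆ bs → ∀ D → Profile bs a D → Solves q bs) → Solves (n + q) as
  profile {q} {as} a next = subst (λ c → Solves (c + q) as) (length-tabulate id′)
    (profile-of a (allFin n) λ bs as⊆bs D known → next bs as⊆bs D λ x → known x (∈-allFin x))
    where id′ : Fin n → Fin n
          id′ x = x

  Near : Fin n → (Fin n → ℕ) → Set
  Near a D = ∀ x → x ≡ a ⊎ D x ≤ 2

  Far : Fin n → (Fin n → ℕ) → Set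
  Far a D = ∃ λ x → x ≢ a × D x ≡ 4

  module Profiled {bs a D} (prof : Profile bs a D) (ρ : Permutation′ n) (agrees : All (Agrees ρ) bs) where

    D≡Δ : ∀ x → x ≢ a → D x ≡ Δ ρ a x
    D≡Δ x x≢a = All.lookup agrees (prof x x≢a)

    ≢-by-role : ∀ {x y} → roleIn ρ x ≢ roleIn ρ y → x ≢ y
    ≢-by-role r≢ refl = r≢ refl

    root-seen : roleIn ρ a ≢ U → ∃ λ x → x ≢ a × D x ≡ roleDist (roleIn ρ a) U
    root-seen a≢U = let x , x-U = vertexIn ρ (root , refl) in
      x , ≢-by-role (λ eq → a≢U (trans (sym eq) x-U)) ,
      trans (D≡Δ x (≢-by-role (λ eq → a≢U (trans (sym eq) x-U)))) (cong (roleDist (roleIn ρ a)) x-U)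

    U-near : roleIn ρ a ≡ U → ∀ x → x ≢ a → D x ≤ 2
    U-near a-U x x≢a = subst (_≤ 2) (sym (trans (D≡Δ x x≢a) (cong (λ r → roleDist r (roleIn ρ x)) a-U)))
                             (roleDist-U≤2 (roleIn ρ x))

    W-far : ∀ {j} → roleIn ρ a ≡ W j → ∃ λ x → x ≢ a × D x ≡ 4
    W-far {j} a-W = let z , j′ , z-W , j′≢j = other-W ρ j
                        z≢a = ≢-by-role λ eq → j′≢j (W-injective (trans (sym z-W) (trans eq a-W)))
      in z , z≢a , trans (D≡Δ z z≢a)
                         (trans (cong₂ roleDist a-W z-W) (proj₂ (roleDist-other-leg λ eq → j′≢j (sym eq))))

    V-not-far : ∀ {i} → roleIn ρ a ≡ V i → ∀ x → x ≢ a → D x ≢ 4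
    V-not-far {i} a-V x x≢a eq =
      roleDist-V≢4 i (roleIn ρ x) (trans (sym (cong (λ r → roleDist r (roleIn ρ x)) a-V)) (trans (sym (D≡Δ x x≢a)) eq))

    near-U : (∀ x → x ≢ a → D x ≤ 2) → roleIn ρ a ≡ U
    near-U near with roleIn ρ a in a-r
    ... | U = refl
    ... | V i = let z , j′ , z-W , j′≢i = other-W ρ i
                    z≢a = ≢-by-role λ eq → V≢W (trans (sym a-r) (trans (sym eq) z-W))
                    Dz≡3 = trans (D≡Δ z z≢a)
                                 (trans (cong₂ roleDist a-r z-W) (proj₁ (roleDist-other-leg λ eq → j′≢i (sym eq))))
                in contradiction (near z z≢a) (<⇒≱ (subst (2 <_) (sym Dz≡3) ≤-refl))
    ... | W j = let z , z≢a , Dz≡4 = W-far a-r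
                in contradiction (near z z≢a) (<⇒≱ (subst (2 <_) (sym Dz≡4) (n≤1+n 3)))

    not-root : ¬ Near a D → roleIn ρ a ≢ U
    not-root ¬near a-U = ¬near λ x → Sum.map₂ (U-near a-U x) (toSum (x ≟ᶠ a))

    far-depth : ¬ Near a D → Far a D → roleDist (roleIn ρ a) U ≡ 2
    far-depth ¬near (x , x≢a , Dx≡4) with roleIn ρ a in a-r
    ... | U = contradiction a-r (not-root ¬near)
    ... | V i = contradiction Dx≡4 (V-not-far a-r x x≢a)
    ... | W j = refl

    near-depth : ¬ Near a D → ¬ Far a D → roleDist (roleIn ρ a) U ≡ 1
    near-depth ¬near ¬far with roleIn ρ a in a-r
    ... | U = contradiction a-r (not-root ¬near)
    ... | V i = refl
    ... | W j = contradiction (W-far a-r) ¬far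

  RootContinuation : ℕ → List (Answer n) → Set
  RootContinuation q as = ∀ bs → as ⊆ bs → ∀ u D → Profile bs u D → (∀ x → x ≢ u → D x ≤ 2) → Solves q bs

  -- After profiling a: if no distance exceeds 2 then a is u; otherwise a vertex at
  -- distance d(a, u) is closer to u (d(a, u) = 2 exactly when some distance is 4).
  find-root : ∀ f {q as} a → (∀ ρ → All (Agrees ρ) as → rounds (roleIn ρ a) ≤ f) → RootContinuation q as →
              Solves (f * n + q) as
  find-root zero a fuel _ = give-up λ ρ agrees → <⇒≱ (rounds-positive (roleIn ρ a)) (fuel ρ agrees)
  find-root (suc f) {q} {as} a fuel found = subst (λ c → Solves c as) (sym (+-assoc n (f * n) q)) (profile a next)
    where
    next : ∀ bs → as ⊆ bs → ∀ D → Profile bs a D → Solves (f * n + q) bs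
    next bs as⊆bs D prof =
      decide (all? λ x → (x ≟ᶠ a) ⊎-dec (D x ≤? 2)) (any? λ x → ¬? (x ≟ᶠ a) ×-dec (D x ≟ 4))
      where
      open Profiled prof

      descend : ¬ Near a D → ∀ t → (∀ ρ → All (Agrees ρ) bs → roleDist (roleIn ρ a) U ≡ t) →
                Solves (f * n + q) bs
      descend ¬near t depth with any? (λ x → ¬? (x ≟ᶠ a) ×-dec (D x ≟ t))
      ... | yes (x , x≢a , Dx≡t) = find-root f x closer λ bs′ bs⊆bs′ → found bs′ (λ a∈ → bs⊆bs′ (as⊆bs a∈))
        where
        closer : ∀ ρ → All (Agrees ρ) bs → rounds (roleIn ρ x) ≤ f
        closer ρ agrees = ≤-pred (≤-trans
          (rounds-decrease (roleIn ρ a) (roleIn ρ x) (not-root ρ agrees ¬near)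
                           (trans (sym (D≡Δ ρ agrees x x≢a)) (trans Dx≡t (sym (depth ρ agrees)))))
          (fuel ρ (anti-mono as⊆bs agrees)))
      ... | no none = give-up λ ρ agrees →
        let x , x≢a , Dx = root-seen ρ agrees (not-root ρ agrees ¬near) in none (x , x≢a , trans Dx (depth ρ agrees))

      decide : Dec (Near a D) → Dec (Far a D) → Solves (f * n + q) bs
      decide (yes near) _ = Solves-mono (m≤n+m q (f * n))
        (found bs as⊆bs a D prof λ x x≢a → [ flip contradiction x≢a , (λ le → le) ] (near x))
      decide (no ¬near) (yes far) = descend ¬near 2 λ ρ agrees → far-depth ρ agrees ¬near far
      decide (no ¬near) (no ¬far) = descend ¬near 1 λ ρ agrees → near-depth ρ agrees ¬near ¬far

  module Matching {b₀ u D} (prof : Profile b₀ u D) (near : ∀ x → x ≢ u → D x ≤ 2) where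

    Inner Outer : Fin n → Set
    Inner x = x ≢ u × D x ≡ 1
    Outer x = x ≢ u × D x ≡ 2

    outer? : ∀ x → Dec (Outer x)
    outer? x = ¬? (x ≟ᶠ u) ×-dec (D x ≟ 2)

    module Roles {bs} (b₀⊆bs : b₀ ⊆ bs) (ρ : Permutation′ n) (agrees : All (Agrees ρ) bs) where

      u-root : roleIn ρ u ≡ U
      u-root = Profiled.near-U prof ρ (anti-mono b₀⊆bs agrees) near

      depth : ∀ x → x ≢ u → D x ≡ roleDist U (roleIn ρ x)
      depth x x≢u = trans (Profiled.D≡Δ prof ρ (anti-mono b₀⊆bs agrees) x x≢u)
                          (cong (λ r → roleDist r (roleIn ρ x)) u-root)

      is-u : ∀ {x} → roleIn ρ x ≡ U → x ≡ u
      is-u x-U = roleIn-injective ρ (trans x-U (sym u-root))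

      not-u : ∀ {x} → roleIn ρ x ≢ U → x ≢ u
      not-u x≢U refl = x≢U u-root

      Inner-V : ∀ {x} → Inner x → IsV (roleIn ρ x)
      Inner-V {x} (x≢u , Dx≡1) = roleDist-U≡1 (roleIn ρ x) (trans (sym (depth x x≢u)) Dx≡1)

      Outer-W : ∀ {x} → Outer x → IsW (roleIn ρ x)
      Outer-W {x} (x≢u , Dx≡2) = roleDist-U≡2 (roleIn ρ x) (trans (sym (depth x x≢u)) Dx≡2)

      V-Inner : ∀ {x i} → roleIn ρ x ≡ V i → Inner x
      V-Inner {x} x-V = x≢u , trans (depth x x≢u) (cong (roleDist U) x-V)
        where x≢u = not-u λ eq → V≢U (trans (sym x-V) eq)

      W-Outer : ∀ {x j} → roleIn ρ x ≡ W j → Outer x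
      W-Outer {x} x-W = x≢u , trans (depth x x≢u) (cong (roleDist U) x-W)
        where x≢u = not-u λ eq → W≢U (trans (sym x-W) eq)

    Pairs : Set
    Pairs = List (Fin n × Fin n)

    Matched : List (Answer n) → Pairs → Set
    Matched bs M = ∀ {v w} → (v , w) ∈ M → Known bs v w 1 × Inner v × Outer w

    Candidate : Pairs → Fin n → Set
    Candidate M x = Inner x × x ∉ map proj₁ M

    candidate? : ∀ M x → Dec (Candidate M x)
    candidate? M x = (¬? (x ≟ᶠ u) ×-dec (D x ≟ 1)) ×-dec ¬? (x ∈? map proj₁ M)

    candidates : Pairs → List (Fin n)
    candidates M = filter (candidate? M) (allFin n)

    candidates-sound : ∀ {M x} → x ∈ candidates M → Candidate M x
    candidates-sound {M} x∈ = proj₂ (∈-filter⁻ (candidate? M) {xs = allFin n} x∈)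

    candidates-bound : ∀ {bs M} → b₀ ⊆ bs → ∀ ρ → All (Agrees ρ) bs → Matched bs M → Unique (map proj₁ M) →
                       length (candidates M) + length M ≤ k
    candidates-bound {bs} {M} b₀⊆bs ρ agrees matched uM = begin
      length (candidates M) + length M               ≡⟨ cong (length (candidates M) +_) (sym (length-map proj₁ M)) ⟩
      length (candidates M) + length (map proj₁ M)   ≡⟨ sym (length-++ (candidates M)) ⟩
      length (candidates M ++ map proj₁ M)           ≤⟨ V-count ρ unique all-V ⟩
      k                                              ∎
      where
      open ≤-Reasoning
      open Roles b₀⊆bs ρ agrees
      unique : Unique (candidates M ++ map proj₁ M)
      unique = Unique.++⁺ (Unique.filter⁺ (candidate? M) (Unique.allFin⁺ n)) uM
                          λ (x∈c , x∈M) → proj₂ (candidates-sound x∈c) x∈M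
      all-V : ∀ {x} → x ∈ candidates M ++ map proj₁ M → IsV (roleIn ρ x)
      all-V x∈ with ∈-++⁻ (candidates M) x∈
      ... | inj₁ x∈c = Inner-V (proj₁ (candidates-sound x∈c))
      ... | inj₂ x∈M with ∈-map⁻ proj₁ x∈M
      ...   | _ , vw∈ , refl = Inner-V (proj₁ (proj₂ (matched vw∈)))

    module Search {bs M w} (b₀⊆bs : b₀ ⊆ bs) (matched : Matched bs M) (uM : Unique (map proj₁ M))
                  (w-outer : Outer w) (w-free : ∀ {v} → (v , w) ∉ M)
                  {R} (found : ∀ bs′ → bs ⊆ bs′ → ∀ p → Candidate M p → Known bs′ p w 1 → Solves R bs′) where

      Rejected : List (Answer n) → Fin n → Set
      Rejected bs′ p = ∃ λ d → Known bs′ p w d × d ≢ 1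

      partner-candidate : ∀ {bs′} → bs ⊆ bs′ → ∀ ρ → All (Agrees ρ) bs′ → ∃ λ p → Candidate M p × Δ ρ p w ≡ 1
      partner-candidate bs⊆bs′ ρ agrees with IsW-leg (Roles.Outer-W (λ a∈ → bs⊆bs′ (b₀⊆bs a∈)) ρ agrees w-outer)
      ... | j , w-W with partnerIn ρ w w-W
      ...   | p , p-V = p , (V-Inner p-V , unmatched) , trans (cong₂ roleDist p-V w-W) (Adjacent⇒roleDist≡1 (V-W j))
        where
        open Roles (λ a∈ → bs⊆bs′ (b₀⊆bs a∈)) ρ agrees
        unmatched : p ∉ map proj₁ M
        unmatched p∈ with ∈-map⁻ proj₁ p∈
        ... | (_ , w′) , pw′∈ , refl = w-free (subst (λ z → (p , z) ∈ M) (roleIn-injective ρ w′-W) pw′∈)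
          where
          adj : Adjacent (V j) (roleIn ρ w′)
          adj = subst (λ r → Adjacent r (roleIn ρ w′)) p-V
                  (roleDist≡1⇒Adjacent _ _ (sym (All.lookup agrees (bs⊆bs′ (proj₁ (matched pw′∈))))))
          w′-W : roleIn ρ w′ ≡ roleIn ρ w
          w′-W = trans (Adjacent-W-unique (Outer-W (proj₂ (proj₂ (matched pw′∈)))) (isW j) (Adjacent-sym adj) (W-V j))
                       (sym w-W)

      scan : ∀ xs {bs′} → bs ⊆ bs′ → All (Candidate M) xs →
             (∀ p → Candidate M p → p ∈ xs ⊎ Rejected bs′ p) → Solves (length xs + R) bs′
      scan [] bs⊆bs′ _ cover = give-up λ ρ agrees →
        let p , cand , adj = partner-candidate bs⊆bs′ ρ agrees
        in [ (λ ()) , (λ (d , known , d≢1) → d≢1 (trans (All.lookup agrees known) adj)) ] (cover p cand)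
      scan (x ∷ xs) {bs′} bs⊆bs′ (x-cand ∷ cands) cover = query x w x≢w λ d → answer d (d ≟ 1)
        where
        x≢w : x ≢ w
        x≢w refl = contradiction (trans (sym (proj₂ (proj₁ x-cand))) (proj₂ w-outer)) λ ()
        answer : ∀ d → Dec (d ≡ 1) → Solves (length xs + R) (⟨ x , w ↦ d ⟩ ∷ bs′)
        answer d (yes refl) =
          Solves-mono (m≤n+m R (length xs)) (found _ (λ a∈ → there (bs⊆bs′ a∈)) x x-cand (here refl))
        answer d (no d≢1) = scan xs (λ a∈ → there (bs⊆bs′ a∈)) cands cover′
          where
          cover′ : ∀ p → Candidate M p → p ∈ xs ⊎ Rejected (⟨ x , w ↦ d ⟩ ∷ bs′) p
          cover′ p cand with cover p cand
          ... | inj₁ (here refl) = inj₂ (d , here refl , d≢1)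
          ... | inj₁ (there p∈xs) = inj₁ p∈xs
          ... | inj₂ (d′ , known , d′≢1) = inj₂ (d′ , there known , d′≢1)

      search : Solves (k ∸ length M + R) bs
      search with length (candidates M) ≤? k ∸ length M
      ... | yes few = Solves-mono (+-monoˡ-≤ R few)
        (scan (candidates M) (λ a∈ → a∈) (all-filter (candidate? M) (allFin n))
              λ p cand → inj₁ (∈-filter⁺ (candidate? M) (∈-allFin p) cand))
      ... | no many = give-up λ ρ agrees → many (m+n≤o⇒m≤o∸n _ (candidates-bound b₀⊆bs ρ agrees matched uM))

    Edge : Pairs → Fin n → Fin n → Set
    Edge M a b = (a ≡ u × Inner b) ⊎ (b ≡ u × Inner a) ⊎ (a , b) ∈ M ⊎ (b , a) ∈ M

    module Complete {bs M} (b₀⊆bs : b₀ ⊆ bs) (matched : Matched bs M)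
                    (covered : ∀ x → Outer x → ∃ λ v → (v , x) ∈ M)
                    (ρ : Permutation′ n) (agrees : All (Agrees ρ) bs) where
      open Roles b₀⊆bs ρ agrees

      matched-adjacent : ∀ {v w} → (v , w) ∈ M → Adjacent (roleIn ρ v) (roleIn ρ w)
      matched-adjacent vw∈ = roleDist≡1⇒Adjacent _ _ (sym (All.lookup agrees (proj₁ (matched vw∈))))

      root-adjacent : ∀ {x} → Inner x → Adjacent (roleIn ρ u) (roleIn ρ x)
      root-adjacent {x} (x≢u , Dx≡1) =
        roleDist≡1⇒Adjacent _ _
          (trans (cong (λ r → roleDist r (roleIn ρ x)) u-root) (trans (sym (depth x x≢u)) Dx≡1))

      partner-matched : ∀ {v w j} → roleIn ρ v ≡ V j → roleIn ρ w ≡ W j → (v , w) ∈ M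
      partner-matched {v} {w} v-V w-W with covered w (W-Outer w-W)
      ... | v′ , v′w∈ = subst (λ z → (z , w) ∈ M) (roleIn-injective ρ (trans v′-V (sym v-V))) v′w∈
        where v′-V = Adjacent-to-W (subst (Adjacent _) w-W (matched-adjacent v′w∈))

      Edge⇒Adjacent : ∀ a b → Edge M a b → Adjacent (roleIn ρ a) (roleIn ρ b)
      Edge⇒Adjacent a b (inj₁ (refl , b-inner)) = root-adjacent b-inner
      Edge⇒Adjacent a b (inj₂ (inj₁ (refl , a-inner))) = Adjacent-sym (root-adjacent a-inner)
      Edge⇒Adjacent a b (inj₂ (inj₂ (inj₁ ab∈))) = matched-adjacent ab∈
      Edge⇒Adjacent a b (inj₂ (inj₂ (inj₂ ba∈))) = Adjacent-sym (matched-adjacent ba∈)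

      Adjacent⇒Edge : ∀ a b → Adjacent (roleIn ρ a) (roleIn ρ b) → Edge M a b
      Adjacent⇒Edge a b adj with roleIn ρ a in a-r | roleIn ρ b in b-r | adj
      ... | U | V _ | U-V _ = inj₁ (is-u a-r , V-Inner b-r)
      ... | V _ | U | V-U _ = inj₂ (inj₁ (is-u b-r , V-Inner a-r))
      ... | V _ | W _ | V-W _ = inj₂ (inj₂ (inj₁ (partner-matched a-r b-r)))
      ... | W _ | V _ | W-V _ = inj₂ (inj₂ (inj₂ (partner-matched b-r a-r)))

    determined : ∀ {bs M} → b₀ ⊆ bs → Matched bs M → (∀ x → Outer x → ∃ λ v → (v , x) ∈ M) → Determined bs
    determined {bs} b₀⊆bs matched covered π ρ cπ cρ a b = T-injective (transfer π ρ cπ cρ) (transfer ρ π cρ cπ)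
      where
      transfer : ∀ σ τ → Consistent σ bs → Consistent τ bs → T (copy σ a b) → T (copy τ a b)
      transfer σ τ cσ cτ e = Adjacent⇒edge (τ ⟨$⟩ˡ a) (τ ⟨$⟩ˡ b)
        (Complete.Edge⇒Adjacent b₀⊆bs matched covered τ (Consistent⇒Agrees τ cτ) a b
          (Complete.Adjacent⇒Edge b₀⊆bs matched covered σ (Consistent⇒Agrees σ cσ) a b
            (edge⇒Adjacent (σ ⟨$⟩ˡ a) (σ ⟨$⟩ˡ b) e)))

    -- Matching the next w costs at most k ∸ length M queries, whence the budget.
    match-all : ∀ ts {bs} M → b₀ ⊆ bs → Unique ts → Matched bs M → Unique (map proj₁ M) →
                (∀ {v w} → (v , w) ∈ M → w ∉ ts) → (∀ x → Outer x → x ∈ ts ⊎ ∃ λ v → (v , x) ∈ M) →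
                Solves (choose2 (suc (k ∸ length M))) bs
    match-all [] M b₀⊆bs _ matched _ _ covered =
      stop (determined b₀⊆bs matched λ x outer → [ (λ ()) , (λ m → m) ] (covered x outer))
    match-all (w ∷ ts) {bs} M b₀⊆bs (w∉ts ∷ uts) matched uM done covered with outer? w
    ... | no ¬outer = match-all ts M b₀⊆bs uts matched uM (λ vw∈ w∈ → done vw∈ (there w∈)) covered′
      where
      covered′ : ∀ x → Outer x → x ∈ ts ⊎ ∃ λ v → (v , x) ∈ M
      covered′ x outer with covered x outer
      ... | inj₁ (here refl) = contradiction outer ¬outer
      ... | inj₁ (there x∈) = inj₁ x∈
      ... | inj₂ vx∈ = inj₂ vx∈
    ... | yes outer = subst (λ c → Solves c bs) (+-comm (k ∸ length M) (choose2 (k ∸ length M)))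
                        (Search.search b₀⊆bs matched uM outer (λ vw∈ → done vw∈ (here refl)) extend)
      where
      extend : ∀ bs′ → bs ⊆ bs′ → ∀ p → Candidate M p → Known bs′ p w 1 → Solves (choose2 (k ∸ length M)) bs′
      extend bs′ bs⊆bs′ p (p-inner , p∉M) known = Solves-mono (choose2-shrink k (length M))
        (match-all ts ((p , w) ∷ M) (λ a∈ → bs⊆bs′ (b₀⊆bs a∈)) uts matched′ (¬Any⇒All¬ _ p∉M ∷ uM)
                   done′ covered′)
        where
        matched′ : Matched bs′ ((p , w) ∷ M)
        matched′ (here refl) = known , p-inner , outer
        matched′ (there vw∈) = let kn , v-inner , w-outer = matched vw∈ in bs⊆bs′ kn , v-inner , w-outer
        done′ : ∀ {v w′} → (v , w′) ∈ (p , w) ∷ M → w′ ∉ ts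
        done′ (here refl) = All¬⇒¬Any w∉ts
        done′ (there vw∈) w′∈ = done vw∈ (there w′∈)
        covered′ : ∀ x → Outer x → x ∈ ts ⊎ ∃ λ v → (v , x) ∈ (p , w) ∷ M
        covered′ x o with covered x o
        ... | inj₁ (here refl) = inj₂ (p , here refl)
        ... | inj₁ (there x∈) = inj₁ x∈
        ... | inj₂ (v , vx∈) = inj₂ (v , there vx∈)

  solves : Solves (3 * n + choose2 (suc k)) []
  solves = find-root 3 root (λ ρ _ → rounds≤3 (roleIn ρ root)) λ bs _ u D prof near →
    Matching.match-all prof near (allFin n) [] (λ a∈ → a∈) (Unique.allFin⁺ n) (λ ()) [] (λ ())
                       (λ x _ → inj₁ (∈-allFin x))

upper-arithmetic : ∀ n k → k + k ≤ n → 8 * (3 * n + choose2 (suc k)) ≤ n * n + 26 * n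
upper-arithmetic n k 2k≤n = begin
  8 * (3 * n + choose2 (suc k))       ≡⟨ lemma₁ n (choose2 (suc k)) ⟩
  24 * n + 4 * (2 * choose2 (suc k))  ≡⟨ cong (λ c → 24 * n + 4 * c) (2*choose2 k) ⟩
  24 * n + 4 * (suc k * k)            ≡⟨ cong (24 * n +_) (lemma₂ k) ⟩
  24 * n + (k + k) * (k + k + 2)      ≤⟨ +-monoʳ-≤ (24 * n) (*-mono-≤ 2k≤n (+-monoˡ-≤ 2 2k≤n)) ⟩
  24 * n + n * (n + 2)                ≡⟨ lemma₃ n ⟩
  n * n + 26 * n                      ∎
  where
  open ≤-Reasoning
  lemma₁ : ∀ n c → 8 * (3 * n + c) ≡ 24 * n + 4 * (2 * c)
  lemma₁ = solve-∀
  lemma₂ : ∀ k → 4 * (suc k * k) ≡ (k + k) * (k + k + 2)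
  lemma₂ = solve-∀
  lemma₃ : ∀ n → 24 * n + n * (n + 2) ≡ n * n + 26 * n
  lemma₃ = solve-∀

lower-arithmetic : ∀ n K q → n ≤ K + K + 2 → K ≤ n → choose2 K ≤ q → n * n ≤ 8 * q + 26 * n
lower-arithmetic n zero q n≤2 _ _ = begin
  n * n           ≤⟨ *-monoʳ-≤ n n≤2 ⟩
  n * 2           ≤⟨ *-monoʳ-≤ n (m≤m+n 2 24) ⟩
  n * 26          ≡⟨ *-comm n 26 ⟩
  26 * n          ≤⟨ m≤n+m (26 * n) (8 * q) ⟩
  8 * q + 26 * n  ∎
  where open ≤-Reasoning
lower-arithmetic n (suc K) q n≤2L+2 L≤n pairs≤q = begin
  n * n                                     ≤⟨ *-mono-≤ n≤2L+2 n≤2L+2 ⟩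
  (suc K + suc K + 2) * (suc K + suc K + 2) ≡⟨ square K ⟩
  4 * (suc K * K) + (12 * suc K + 4)        ≡⟨ cong (λ c → 4 * c + (12 * suc K + 4)) (sym (2*choose2 K)) ⟩
  4 * (2 * choose2 (suc K)) + (12 * suc K + 4) ≡⟨ cong (_+ (12 * suc K + 4)) (sym (*-assoc 4 2 (choose2 (suc K)))) ⟩
  8 * choose2 (suc K) + (12 * suc K + 4)    ≤⟨ +-mono-≤ (*-monoʳ-≤ 8 pairs≤q) linear ⟩
  8 * q + 26 * n                            ∎
  where
  open ≤-Reasoning
  square : ∀ K → (suc K + suc K + 2) * (suc K + suc K + 2) ≡ 4 * (suc K * K) + (12 * suc K + 4)
  square = solve-∀
  linear : 12 * suc K + 4 ≤ 26 * n
  linear = begin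
    12 * suc K + 4          ≤⟨ +-monoʳ-≤ (12 * suc K) (*-monoʳ-≤ 4 (s≤s (z≤n {K}))) ⟩
    12 * suc K + 4 * suc K  ≡⟨ sym (*-distribʳ-+ (suc K) 12 4) ⟩
    16 * suc K              ≤⟨ *-mono-≤ (m≤m+n 16 10) L≤n ⟩
    26 * n                  ∎

at-least-two-W : ∀ m → 4 ≤ m → 2 + ⌊ suc m /2⌋ < suc m
at-least-two-W m 4≤m = begin
  3 + ⌊ suc m /2⌋            ≤⟨ +-monoˡ-≤ ⌊ suc m /2⌋ (⌊n/2⌋-mono (s≤s (s≤s 4≤m))) ⟩
  ⌈ suc m /2⌉ + ⌊ suc m /2⌋  ≡⟨ +-comm ⌈ suc m /2⌉ ⌊ suc m /2⌋ ⟩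
  ⌊ suc m /2⌋ + ⌈ suc m /2⌉  ≡⟨ ⌊n/2⌋+⌈n/2⌉≡n (suc m) ⟩
  suc m                      ∎
  where open ≤-Reasoning

n≤2K+2 : ∀ m → suc m ≤ (m ∸ ⌊ suc m /2⌋) + (m ∸ ⌊ suc m /2⌋) + 2
n≤2K+2 m = begin
  suc m              ≡⟨ cong suc (sym (m∸n+n≡m k≤m)) ⟩
  suc (K + k)        ≤⟨ s≤s (+-monoʳ-≤ K k≤1+K) ⟩
  suc (K + suc K)    ≡⟨ rearrange K ⟩
  K + K + 2          ∎
  where
  open ≤-Reasoning
  rearrange : ∀ K → suc (K + suc K) ≡ K + K + 2
  rearrange = solve-∀
  k = ⌊ suc m /2⌋
  K = m ∸ k
  k≤m : k ≤ m
  k≤m = ≤-pred (⌊n/2⌋<n m)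
  k≤1+K : k ≤ suc K
  k≤1+K = +-cancelʳ-≤ k k (suc K) (≤-trans (half-lower (suc m)) (≤-reflexive (cong suc (sym (m∸n+n≡m k≤m)))))

proposition1p4 : ∃₂ λ (C N : ℕ) → ∀ (m : ℕ) → N ≤ m →
                   (∃ λ (q : ℕ) → Solves {suc m} q [] × 8 * q ≤ suc m * suc m + C * suc m)
                   × (∀ (q : ℕ) → Solves {suc m} q [] → suc m * suc m ≤ 8 * q + C * suc m)
proposition1p4 = 26 , 4 , λ m 4≤m →
  (3 * suc m + choose2 (suc ⌊ suc m /2⌋) , UpperBound.solves m (at-least-two-W m 4≤m) ,
     upper-arithmetic (suc m) ⌊ suc m /2⌋ (half-lower (suc m)))
  , λ q solves → lower-arithmetic (suc m) (m ∸ ⌊ suc m /2⌋) q (n≤2K+2 m)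
                   (≤-trans (m∸n≤m m ⌊ suc m /2⌋) (n≤1+n m)) (LowerBound.lower-bound m q solves)
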